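{- Let $n\ge3$, $\lambda\in\mathbb{Z}_{\ge0}^n$, and let $\mathbf w=[w_1,w_2,\dots]$ be an infinite sequence in $\{1,\dots,n\}$ with $w_{t+1}\ne w_t$ for all $t$. Set ${}_0x=(1,\dots,1)$, ${}_{t+1}x=\mu_{w_{t+1}}({}_tx)$, and define the ratio numbers \[ k_{t+1}=\frac{{}_{t+1}x_{w_{t+1}}}{\prod_{i\ne w_{t+1}}{}_tx_i}\qquad(t\ge0). \] Then the sequence $(k_t)_{t\ge1}$ is strictly increasing.
   Context: For a point $(x_1,\dots,x_n)$ with positive entries, the mutation $\mu_i$ replaces $x_i$ by $x_i'=\big(\sum_{j\ne i}x_j^2+\lambda_i\prod_{j\ne i}x_j\big)/x_i$ and leaves the other coordinates unchanged. -}

module Defs where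

open import Data.Nat using (ℕ; zero; suc)
open import Data.Fin using (Fin; zero; suc; _≟_)
open import Data.Rational using (ℚ; 0ℚ; 1ℚ; _+_; _*_; _÷_; ≢-nonZero; _/_)
import Data.Rational.Properties as ℚP
open import Relation.Nullary using (yes; no)

sumFin : ∀ {n} → (Fin n → ℚ) → ℚ
sumFin {zero} f = 0ℚ
sumFin {suc n} f = f zero + sumFin (λ j → f (suc j))

prodFin : ∀ {n} → (Fin n → ℚ) → ℚ
prodFin {zero} f = 1ℚ
prodFin {suc n} f = f zero * prodFin (λ j → f (suc j))

-- total division: p / q for q ≠ 0, junk value 0 when q = 0
-- (never hit on the orbit, since all entries stay positive)
divQ : ℚ → ℚ → ℚ
divQ p q with q ℚP.≟ 0ℚ
... | yes _ = 0ℚ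
... | no q≢0 = _÷_ p q {{≢-nonZero q≢0}}

unlessAt : ∀ {n} → Fin n → ℚ → (Fin n → ℚ) → Fin n → ℚ
unlessAt i d f j with j ≟ i
... | yes _ = d
... | no _ = f j

sumExcept : ∀ {n} → Fin n → (Fin n → ℚ) → ℚ
sumExcept i f = sumFin (unlessAt i 0ℚ f)

prodExcept : ∀ {n} → Fin n → (Fin n → ℚ) → ℚ
prodExcept i f = prodFin (unlessAt i 1ℚ f)

ℕtoℚ : ℕ → ℚ
ℕtoℚ m = Data.Rational.mkℚ+ m 1 (Data.Nat.Coprimality.sym (Data.Nat.Coprimality.1-coprimeTo m))
  where import Data.Nat.Coprimality

mutate : ∀ {n} → (Fin n → ℕ) → Fin n → (Fin n → ℚ) → Fin n → ℚ
mutate lam i x j with j ≟ i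
... | yes _ = divQ (sumExcept i (λ l → x l * x l) + ℕtoℚ (lam i) * prodExcept i x) (x i)
... | no _ = x j

-- orbit: orbit 0 = (1,…,1), orbit (t+1) = μ_{w t} (orbit t);
-- here w t stands for the paper's w_{t+1}
orbit : ∀ {n} → (Fin n → ℕ) → (ℕ → Fin n) → ℕ → Fin n → ℚ
orbit lam w zero = λ _ → 1ℚ
orbit lam w (suc t) = mutate lam (w t) (orbit lam w t)

-- ratio number: ratio lam w t = paper's k_{t+1}
--   = (t+1)x_{w_{t+1}} / ∏_{i ≠ w_{t+1}} (t)x_i
ratio : ∀ {n} → (Fin n → ℕ) → (ℕ → Fin n) → ℕ → ℚ
ratio lam w t = divQ (orbit lam w (suc t) (w t)) (prodExcept (w t) (orbit lam w t))

{-# OPTIONS --safe #-}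
-- Write i = w_{t+1}, j = w_{t+2}, x = ₜx and x' = μ_i x, and let Q and R be the product
-- of the x_l and the sum of the x_l² over l ∉ {i, j}. Then k_{t+1} = x'_i / (x_j Q), while
-- x'' = μ_j x' has x''_j = (x'_i² + R + λ_j x'_i Q) / x_j, so
-- k_{t+2} = (x'_i² + R + λ_j x'_i Q) / (x'_i x_j Q). Since every entry stays positive and
-- R > 0 once n ≥ 3, the second numerator exceeds x'_i², giving k_{t+1} < k_{t+2}.
module Submission where

open import Defs
open import Data.Nat using (ℕ; _≥_)
open import Data.Fin using (Fin)
open import Data.Rational using (_<_)
open import Relation.Binary.PropositionalEquality using (_≢_)

open import Algebra.Bundles using (CommutativeMonoid)
import Algebra.Properties.CommutativeMonoid.Sum as MonoidSum
open import Data.Fin using (zero; suc)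
open import Data.Fin.Properties using (_≟_; punchInᵢ≢i)
open import Data.Nat using (zero; suc; s≤s; z≤n)
open import Data.Product using (∃-syntax; _×_; _,_; proj₁; proj₂; map₂)
open import Data.Rational using (ℚ; 0ℚ; 1ℚ; _+_; _*_; _÷_; 1/_; _≤_; Positive; NonNegative)
open import Data.Rational.Properties
  using ( +-0-isCommutativeMonoid; *-1-isCommutativeMonoid; +-identityʳ; *-identityʳ
        ; *-assoc; *-inverseˡ; +-monoʳ-<; +-monoʳ-≤; *-cancelʳ-<-nonNeg
        ; positive⁻¹; nonNegative⁻¹; pos⇒nonZero; pos⇒nonNeg; 1/pos⇒pos
        ; pos+nonNeg⇒pos; nonNeg+nonNeg⇒nonNeg; pos*pos⇒pos; nonNeg*nonNeg⇒nonNeg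
        ; module ≤-Reasoning)
  renaming (_≟_ to _≟ℚ_)
open import Data.Rational.Solver using (module +-*-Solver)
open import Data.Vec.Functional using (removeAt)
open import Data.Vec.Functional.Relation.Unary.All using (All)
open import Function using (_∘_)
open import Relation.Binary.PropositionalEquality
  using (_≡_; refl; sym; trans; cong; cong₂; subst; _≗_; module ≡-Reasoning)
open import Relation.Nullary using (yes; no; contradiction)
open import Algebra.Structures {A = ℚ} _≡_ using (IsCommutativeMonoid)

open +-*-Solver using (solve; _:*_; _:=_)

module _ {n : ℕ} {i : Fin n} {d : ℚ} where

  unlessAt-≡ : (f : Fin n → ℚ) → unlessAt i d f i ≡ d
  unlessAt-≡ f with i ≟ i
  ... | yes _ = refl
  ... | no i≢i = contradiction refl i≢i

  unlessAt-≢ : (f : Fin n → ℚ) {l : Fin n} → l ≢ i → unlessAt i d f l ≡ f l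
  unlessAt-≢ f {l} l≢i with l ≟ i
  ... | yes l≡i = contradiction l≡i l≢i
  ... | no _ = refl

  unlessAt-cong : {f g : Fin n → ℚ} → (∀ l → l ≢ i → f l ≡ g l) →
                  unlessAt i d f ≗ unlessAt i d g
  unlessAt-cong f≡g l with l ≟ i
  ... | yes _ = refl
  ... | no l≢i = f≡g l l≢i

  unlessAt-all : (P : ℚ → Set) {f : Fin n → ℚ} → P d → All P f → All P (unlessAt i d f)
  unlessAt-all P Pd Pf l with l ≟ i
  ... | yes _ = Pd
  ... | no _ = Pf l

unlessAt-comm : ∀ {n} (i j : Fin n) {d : ℚ} (f : Fin n → ℚ) →
                unlessAt i d (unlessAt j d f) ≗ unlessAt j d (unlessAt i d f)
unlessAt-comm i j f l with l ≟ i | l ≟ j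
... | yes _    | yes _    = refl
... | yes refl | no _     = sym (unlessAt-≡ {i = i} f)
... | no _     | yes refl = unlessAt-≡ {i = j} f
... | no l≢i   | no l≢j   = trans (unlessAt-≢ f l≢j) (sym (unlessAt-≢ f l≢i))

module FoldExcept {_∙_ : ℚ → ℚ → ℚ} {ε : ℚ} (isCM : IsCommutativeMonoid _∙_ ε)
  (fold : ∀ {n} → (Fin n → ℚ) → ℚ)
  (fold-zero : (f : Fin 0 → ℚ) → fold f ≡ ε)
  (fold-suc : ∀ {n} (f : Fin (suc n) → ℚ) → fold f ≡ f zero ∙ fold (f ∘ suc)) where

  open IsCommutativeMonoid isCM using (identityˡ)
  open ≡-Reasoning

  commutativeMonoid : CommutativeMonoid _ _
  commutativeMonoid = record { isCommutativeMonoid = isCM }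

  open MonoidSum commutativeMonoid using (sum; sum-remove; sum-cong-≗)

  fold≡sum : ∀ {n} (f : Fin n → ℚ) → fold f ≡ sum f
  fold≡sum {zero} f = fold-zero f
  fold≡sum {suc n} f = trans (fold-suc f) (cong (f zero ∙_) (fold≡sum (f ∘ suc)))

  fold-cong : ∀ {n} {f g : Fin n → ℚ} → f ≗ g → fold f ≡ fold g
  fold-cong {f = f} {g} f≗g =
    trans (fold≡sum f) (trans (sum-cong-≗ f≗g) (sym (fold≡sum g)))

  foldExcept : ∀ {n} → Fin n → (Fin n → ℚ) → ℚ
  foldExcept i f = fold (unlessAt i ε f)

  foldExcept₂ : ∀ {n} → Fin n → Fin n → (Fin n → ℚ) → ℚ
  foldExcept₂ i j f = fold (unlessAt j ε (unlessAt i ε f))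

  fold-split : ∀ {n} (i : Fin n) (f : Fin n → ℚ) → fold f ≡ f i ∙ foldExcept i f
  fold-split {suc n} i f = begin
    fold f                   ≡⟨ fold≡sum f ⟩
    sum f                    ≡⟨ sum-remove {i = i} f ⟩
    f i ∙ sum (removeAt f i) ≡⟨ cong (f i ∙_) (sum-cong-≗ removeAt-unlessAt) ⟩
    f i ∙ rest               ≡⟨ cong (f i ∙_) (sym (identityˡ rest)) ⟩
    f i ∙ (ε ∙ rest)         ≡⟨ cong (λ e → f i ∙ (e ∙ rest)) (sym (unlessAt-≡ {i = i} f)) ⟩
    f i ∙ (f′ i ∙ rest)      ≡⟨ cong (f i ∙_) (sym (sum-remove {i = i} f′)) ⟩
    f i ∙ sum f′             ≡⟨ cong (f i ∙_) (sym (fold≡sum f′)) ⟩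
    f i ∙ fold f′            ∎
    where
    f′ = unlessAt i ε f
    rest = sum (removeAt f′ i)
    removeAt-unlessAt : removeAt f i ≗ removeAt f′ i
    removeAt-unlessAt k = sym (unlessAt-≢ {i = i} f (punchInᵢ≢i i k))

  foldExcept-split : ∀ {n} {i j : Fin n} (f : Fin n → ℚ) → j ≢ i →
                     foldExcept i f ≡ f j ∙ foldExcept₂ i j f
  foldExcept-split {i = i} {j} f j≢i =
    trans (fold-split j (unlessAt i ε f)) (cong (_∙ foldExcept₂ i j f) (unlessAt-≢ f j≢i))

  foldExcept-split-agree : ∀ {n} {i j : Fin n} {f g : Fin n → ℚ} → j ≢ i →
                           (∀ l → l ≢ i → g l ≡ f l) →
                           foldExcept j g ≡ g i ∙ foldExcept₂ i j f
  foldExcept-split-agree {i = i} {j} {f} {g} j≢i g≡f = begin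
    foldExcept j g          ≡⟨ foldExcept-split g (j≢i ∘ sym) ⟩
    g i ∙ foldExcept₂ j i g ≡⟨ cong (g i ∙_) (fold-cong (unlessAt-comm i j g)) ⟩
    g i ∙ foldExcept₂ i j g ≡⟨ cong (g i ∙_) (fold-cong (unlessAt-cong λ l _ → g≡f′ l)) ⟩
    g i ∙ foldExcept₂ i j f ∎
    where
    g≡f′ : unlessAt i ε g ≗ unlessAt i ε f
    g≡f′ = unlessAt-cong g≡f

module Sum = FoldExcept +-0-isCommutativeMonoid sumFin (λ _ → refl) (λ _ → refl)
module Product = FoldExcept *-1-isCommutativeMonoid prodFin (λ _ → refl) (λ _ → refl)

sumFin-nonNeg : ∀ {n} {f : Fin n → ℚ} → All NonNegative f → NonNegative (sumFin f)
sumFin-nonNeg {zero} _ = _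
sumFin-nonNeg {suc n} {f} f≥0 =
  nonNeg+nonNeg⇒nonNeg (f zero) {{f≥0 zero}} _ {{sumFin-nonNeg (f≥0 ∘ suc)}}

sumFin-pos : ∀ {n} {f : Fin n → ℚ} (k : Fin n) → All NonNegative f → Positive (f k) →
             Positive (sumFin f)
sumFin-pos {f = f} k f≥0 fk>0 = subst Positive (sym (Sum.fold-split k f))
  (pos+nonNeg⇒pos (f k) {{fk>0}} _ {{sumFin-nonNeg rest≥0}})
  where
  rest≥0 : All NonNegative (unlessAt k 0ℚ f)
  rest≥0 = unlessAt-all NonNegative _ f≥0

prodFin-pos : ∀ {n} {f : Fin n → ℚ} → All Positive f → Positive (prodFin f)
prodFin-pos {zero} _ = _
prodFin-pos {suc n} {f} f>0 =
  pos*pos⇒pos (f zero) {{f>0 zero}} _ {{prodFin-pos (f>0 ∘ suc)}}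

divQ≡÷ : ∀ p {q} (q>0 : Positive q) → divQ p q ≡ (p ÷ q) {{pos⇒nonZero q {{q>0}}}}
divQ≡÷ p {q} q>0 with q ≟ℚ 0ℚ
divQ≡÷ p () | yes refl
... | no _ = refl

divQ-pos : ∀ p q → Positive p → Positive q → Positive (divQ p q)
divQ-pos p q p>0 q>0 = subst Positive (sym (divQ≡÷ p q>0))
  (pos*pos⇒pos p {{p>0}} ((1/ q) {{pos⇒nonZero q {{q>0}}}}) {{1/pos⇒pos q {{q>0}}}})

divQ-*-cancel : ∀ p q → Positive q → divQ p q * q ≡ p
divQ-*-cancel p q q>0 = begin
  divQ p q * q  ≡⟨ cong (_* q) (divQ≡÷ p q>0) ⟩
  p * 1/q * q   ≡⟨ *-assoc p 1/q q ⟩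
  p * (1/q * q) ≡⟨ cong (p *_) (*-inverseˡ q {{q≢0}}) ⟩
  p * 1ℚ        ≡⟨ *-identityʳ p ⟩
  p             ∎
  where
  open ≡-Reasoning
  q≢0 = pos⇒nonZero q {{q>0}}
  1/q = (1/ q) {{q≢0}}

p<p+q : ∀ p {q} → Positive q → p < p + q
p<p+q p {q} q>0 = subst (_< p + q) (+-identityʳ p) (+-monoʳ-< p (positive⁻¹ q {{q>0}}))

p≤p+q : ∀ p {q} → NonNegative q → p ≤ p + q
p≤p+q p {q} q≥0 = subst (_≤ p + q) (+-identityʳ p) (+-monoʳ-≤ p (nonNegative⁻¹ q {{q≥0}}))

square<⇒divQ<divQ : ∀ {a b q s} → Positive a → Positive b → Positive q → a * a < s →
                    divQ a (b * q) < divQ (divQ s b) (a * q)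
square<⇒divQ<divQ {a} {b} {q} {s} a>0 b>0 q>0 aa<s =
  *-cancelʳ-<-nonNeg (a * (b * q)) {{pos⇒nonNeg (a * (b * q)) {{abq>0}}}} (begin-strict
    u * (a * (b * q))
      ≡⟨ solve 4 (λ u a b q → u :* (a :* (b :* q)) := (u :* (b :* q)) :* a) refl u a b q ⟩
    u * (b * q) * a
      ≡⟨ cong (_* a) (divQ-*-cancel a (b * q) bq>0) ⟩
    a * a
      <⟨ aa<s ⟩
    s
      ≡⟨ sym (divQ-*-cancel s b b>0) ⟩
    divQ s b * b
      ≡⟨ cong (_* b) (sym (divQ-*-cancel (divQ s b) (a * q) aq>0)) ⟩
    v * (a * q) * b
      ≡⟨ solve 4 (λ v a b q → v :* (a :* q) :* b := v :* (a :* (b :* q))) refl v a b q ⟩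
    v * (a * (b * q))
      ∎)
  where
  open ≤-Reasoning
  u = divQ a (b * q)
  v = divQ (divQ s b) (a * q)
  bq>0 : Positive (b * q)
  bq>0 = pos*pos⇒pos b {{b>0}} q {{q>0}}
  aq>0 : Positive (a * q)
  aq>0 = pos*pos⇒pos a {{a>0}} q {{q>0}}
  abq>0 : Positive (a * (b * q))
  abq>0 = pos*pos⇒pos a {{a>0}} (b * q) {{bq>0}}

squares : ∀ {n} → (Fin n → ℚ) → Fin n → ℚ
squares x l = x l * x l

squares-pos : ∀ {n} (x : Fin n → ℚ) → All Positive x → All Positive (squares x)
squares-pos x x>0 l = pos*pos⇒pos (x l) {{x>0 l}} (x l) {{x>0 l}}

all-pos⇒nonNeg : ∀ {n} (x : Fin n → ℚ) → All Positive x → All NonNegative x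
all-pos⇒nonNeg x x>0 l = pos⇒nonNeg (x l) {{x>0 l}}

ℕtoℚ*prodExcept-nonNeg : ∀ {n} m (i : Fin n) (x : Fin n → ℚ) → All Positive x →
                         NonNegative (ℕtoℚ m * prodExcept i x)
ℕtoℚ*prodExcept-nonNeg m i x x>0 = nonNeg*nonNeg⇒nonNeg (ℕtoℚ m) {{_}} (prodExcept i x)
  {{pos⇒nonNeg (prodExcept i x) {{prodFin-pos (unlessAt-all Positive _ x>0)}}}}

module _ {n : ℕ} (lam : Fin n → ℕ) where

  mutate-≡ : ∀ {i : Fin n} (x : Fin n → ℚ) → mutate lam i x i ≡
             divQ (sumExcept i (squares x) + ℕtoℚ (lam i) * prodExcept i x) (x i)
  mutate-≡ {i} x with i ≟ i
  ... | yes _ = refl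
  ... | no i≢i = contradiction refl i≢i

  mutate-≢ : ∀ {i l : Fin n} (x : Fin n → ℚ) → l ≢ i → mutate lam i x l ≡ x l
  mutate-≢ {i} {l} x l≢i with l ≟ i
  ... | yes l≡i = contradiction l≡i l≢i
  ... | no _ = refl

  mutate-pos : ∀ {i k : Fin n} {x : Fin n → ℚ} → k ≢ i → All Positive x →
               All Positive (mutate lam i x)
  mutate-pos {i} {k} {x} k≢i x>0 l with l ≟ i
  ... | no _ = x>0 l
  ... | yes _ = divQ-pos _ (x i) numerator>0 (x>0 i)
    where
    sumExcept>0 : Positive (sumExcept i (squares x))
    sumExcept>0 =
      sumFin-pos k (unlessAt-all NonNegative _ (all-pos⇒nonNeg (squares x) (squares-pos x x>0)))
        (subst Positive (sym (unlessAt-≢ (squares x) k≢i)) (squares-pos x x>0 k))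
    numerator>0 : Positive (sumExcept i (squares x) + ℕtoℚ (lam i) * prodExcept i x)
    numerator>0 = pos+nonNeg⇒pos (sumExcept i (squares x)) {{sumExcept>0}}
      (ℕtoℚ (lam i) * prodExcept i x) {{ℕtoℚ*prodExcept-nonNeg (lam i) i x x>0}}

  orbit-pos : (w : ℕ → Fin n) → (∀ i → ∃[ k ] k ≢ i) → ∀ t → All Positive (orbit lam w t)
  orbit-pos w another zero = λ _ → _
  orbit-pos w another (suc t) = mutate-pos (proj₂ (another (w t))) (orbit-pos w another t)

  ratio-step : ∀ {i j k : Fin n} (x : Fin n → ℚ) → All Positive x → j ≢ i → k ≢ i → k ≢ j →
               divQ (mutate lam i x i) (prodExcept i x) <
               divQ (mutate lam j (mutate lam i x) j) (prodExcept j (mutate lam i x))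
  ratio-step {i} {j} {k} x x>0 j≢i k≢i k≢j = begin-strict
    divQ a (prodExcept i x)
      ≡⟨ cong (divQ a) (Product.foldExcept-split x j≢i) ⟩
    divQ a (b * Q)
      <⟨ square<⇒divQ<divQ {a} {b} {Q} (x′>0 i) (x>0 j) Q>0 aa<S ⟩
    divQ (divQ S b) (a * Q)
      ≡⟨ cong₂ divQ (sym x″j≡S/b) (sym prodExcept-x′) ⟩
    divQ (mutate lam j x′ j) (prodExcept j x′)
      ∎
    where
    open ≤-Reasoning
    x′ = mutate lam i x
    a = x′ i
    b = x j
    Q = Product.foldExcept₂ i j x
    R = Sum.foldExcept₂ i j (squares x)
    S = sumExcept j (squares x′) + ℕtoℚ (lam j) * prodExcept j x′

    x′≡x : ∀ l → l ≢ i → x′ l ≡ x l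
    x′≡x l = mutate-≢ x
    x′>0 : All Positive x′
    x′>0 = mutate-pos {x = x} k≢i x>0
    x²>0 : All Positive (squares x)
    x²>0 = squares-pos x x>0

    prodExcept-x′ : prodExcept j x′ ≡ a * Q
    prodExcept-x′ = Product.foldExcept-split-agree j≢i x′≡x
    sumExcept-x′ : sumExcept j (squares x′) ≡ a * a + R
    sumExcept-x′ =
      Sum.foldExcept-split-agree j≢i λ l l≢i → cong₂ _*_ (x′≡x l l≢i) (x′≡x l l≢i)
    x″j≡S/b : mutate lam j x′ j ≡ divQ S b
    x″j≡S/b = trans (mutate-≡ {j} x′) (cong (divQ S) (x′≡x j j≢i))

    Q>0 : Positive Q
    Q>0 = prodFin-pos (unlessAt-all Positive _ (unlessAt-all Positive _ x>0))
    R>0 : Positive R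
    R>0 = sumFin-pos k
      (unlessAt-all NonNegative _ (unlessAt-all NonNegative _ (all-pos⇒nonNeg (squares x) x²>0)))
      (subst Positive (sym (trans (unlessAt-≢ _ k≢j) (unlessAt-≢ _ k≢i))) (x²>0 k))
    aa<S : a * a < S
    aa<S = begin-strict
      a * a                    <⟨ p<p+q (a * a) R>0 ⟩
      a * a + R                ≡⟨ sym sumExcept-x′ ⟩
      sumExcept j (squares x′) ≤⟨ p≤p+q _ (ℕtoℚ*prodExcept-nonNeg (lam j) j x′ x′>0) ⟩
      S                        ∎

avoid₂ : ∀ {m} (i j : Fin (suc (suc (suc m)))) → ∃[ k ] k ≢ i × k ≢ j
avoid₂ zero          zero          = suc zero , (λ ()) , (λ ())
avoid₂ zero          (suc zero)    = suc (suc zero) , (λ ()) , (λ ())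
avoid₂ zero          (suc (suc _)) = suc zero , (λ ()) , (λ ())
avoid₂ (suc zero)    zero          = suc (suc zero) , (λ ()) , (λ ())
avoid₂ (suc zero)    (suc _)       = zero , (λ ()) , (λ ())
avoid₂ (suc (suc _)) zero          = suc zero , (λ ()) , (λ ())
avoid₂ (suc (suc _)) (suc _)       = zero , (λ ()) , (λ ())

lemma4p1 : (n : ℕ) → n ≥ 3 → (lam : Fin n → ℕ) → (w : ℕ → Fin n) →
           (∀ t → w (ℕ.suc t) ≢ w t) →
           ∀ t → ratio lam w t < ratio lam w (ℕ.suc t)
lemma4p1 _ (s≤s (s≤s (s≤s z≤n))) lam w w-moves t =
  let orbit>0 = orbit-pos lam w (λ i → map₂ proj₁ (avoid₂ i i)) t
      (k , k≢wₜ , k≢wₜ₊₁) = avoid₂ (w t) (w (suc t))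
  in ratio-step lam (orbit lam w t) orbit>0 (w-moves t) k≢wₜ k≢wₜ₊₁
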